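{- Consider the colorability saturation game on vertex set $V$, and let $G(t)=(V,E_t)$ denote the graph after $t$ edges in total have been played. Let $f:V\rightarrow \mathbb{N}_0$ be a function, write $f(A):=\sum_{v\in A}f(v)$ for $A\subseteq V$, and let $B \subset V$. For $A\subseteq V\setminus B$ and $t\in\mathbb{N}_0$ put $\phi(A,B,t)=|E_t[A]|+|E_t[A,B]|$. Let $t_0 \in \mathbb{N}_0$ be a point in time of the game such that $G(t_0)$ is not saturated (so that an edge is played at time $t_0+1$) and such that $f(A) \ge \phi(A,B,t_0)$ for all $A \subseteq V \setminus B$. Let \[\mathcal{C} := \big\{A \subseteq V \setminus B \mid f(A) < \phi(A,B,t_0+1) \big\}.\] Then either $\mathcal{C}$ is empty, or all of the following hold: (i) $A' := \bigcap_{A \in \mathcal{C}} A$ is non-empty and $A'\in\mathcal{C}$; (ii) for all $A \in \mathcal{C}$ it holds $\phi(A,B,t_0+1)=f(A)+1$; (iii) for all $A \subseteq V \setminus (B \cup A')$ we have $f(A) \ge \phi(A \cup A',B,t_0+1)-\phi(A',B,t_0+1)$.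
   Context: The colorability saturation game with parameters $k,n$: two players start with the empty graph on a vertex set $V$ of $n$ vertices and take turns, each turn adding one edge not yet present, subject to the constraint that the current graph stays $k$-colorable; the game ends when the graph is saturated, i.e., no further edge can be added while keeping it $k$-colorable. $E_t[A]$ is the set of edges of $G(t)$ with both endpoints in $A$, and $E_t[A,B]$ the set of edges of $G(t)$ with one endpoint in $A$ and the other in $B$. -}

module Defs where

open import Data.Nat using (ℕ; zero; suc; _+_; _<_; _<ᵇ_)
open import Data.Bool using (Bool; true; false; _∧_; _∨_; if_then_else_)
open import Data.Fin using (Fin; toℕ)
open import Data.Fin.Properties using (_≟_)
open import Data.Fin.Subset using (Subset)
open import Data.Vec using (lookup)
open import Data.List using (List; []; _∷_; length; take; map; allFin)
open import Data.Nat.ListAction using (sum)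
open import Data.Bool.ListAction using (any)
open import Data.List.Membership.Propositional using (_∈_)
open import Data.Product using (Σ; ∃; _×_; _,_)
open import Relation.Nullary using (¬_; does)
open import Relation.Binary.PropositionalEquality using (_≡_; _≢_)

-- An edge played in the game: an (unordered) pair of vertices, stored as an ordered pair.
Edge : ℕ → Set
Edge n = Fin n × Fin n

_=ᵇ_ : ∀ {n} → Fin n → Fin n → Bool
u =ᵇ v = does (u ≟ v)

adj : ∀ {n} → List (Edge n) → Fin n → Fin n → Bool
adj es u v = any (λ { (a , b) → ((a =ᵇ u) ∧ (b =ᵇ v)) ∨ ((a =ᵇ v) ∧ (b =ᵇ u)) }) es

Colorable : ∀ {n} → ℕ → List (Edge n) → Set
Colorable {n} k es = Σ (Fin n → Fin k) λ c → ∀ {a b} → (a , b) ∈ es → c a ≢ c b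

LegalMove : ∀ {n} → ℕ → List (Edge n) → Edge n → Set
LegalMove k es (a , b) = a ≢ b × adj es a b ≡ false × Colorable k ((a , b) ∷ es)

G : ∀ {n} → List (Edge n) → ℕ → List (Edge n)
G moves t = take t moves

LegalPlay : ∀ {n} → ℕ → List (Edge n) → Set
LegalPlay k moves = (i : Fin (length moves)) → LegalMove k (G moves (toℕ i)) (Data.List.lookup moves i)

Saturated : ∀ {n} → ℕ → List (Edge n) → Set
Saturated {n} k es = Colorable k es × (∀ (a b : Fin n) → ¬ LegalMove k es (a , b))

bool→ℕ : Bool → ℕ
bool→ℕ true = 1
bool→ℕ false = 0

mem : ∀ {n} → Subset n → Fin n → Bool
mem A i = lookup A i

fsum : ∀ {n} → (Fin n → ℕ) → Subset n → ℕ
fsum {n} f A = sum (map (λ v → if mem A v then f v else 0) (allFin n))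

-- |E[A]| : edges with both endpoints in A (each unordered pair counted once via u < v).
eIn : ∀ {n} → List (Edge n) → Subset n → ℕ
eIn {n} es A = sum (map (λ u → sum (map (λ v →
  bool→ℕ ((toℕ u <ᵇ toℕ v) ∧ mem A u ∧ mem A v ∧ adj es u v)) (allFin n))) (allFin n))

-- |E[A,B]| : edges with one endpoint in A and the other in B.
-- (Used with A, B disjoint, so each such edge is counted exactly once.)
eBetween : ∀ {n} → List (Edge n) → Subset n → Subset n → ℕ
eBetween {n} es A B = sum (map (λ u → sum (map (λ v →
  bool→ℕ (mem A u ∧ mem B v ∧ adj es u v)) (allFin n))) (allFin n))

φ : ∀ {n} → List (Edge n) → Subset n → Subset n → ℕ → ℕ
φ moves A B t = eIn (G moves t) A + eBetween (G moves t) A B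

module Submission where

-- φ(A,B,t) is a sum, over the edges of G(t), of a pair weight that is supermodular in A,
-- whereas f is modular. A new edge raises φ(A,B,·) by at most one when A ∩ B = ∅, so
-- φ(·,B,t₀+1) ≤ f + 1 and every member of 𝒞 has excess exactly one. Comparing
-- f(X) + f(Y) = f(X ∪ Y) + f(X ∩ Y) with φ(X) + φ(Y) ≤ φ(X ∪ Y) + φ(X ∩ Y) then shows that
-- 𝒞 is closed under intersection. Hence ⋂𝒞 is the least member of 𝒞, it is nonempty because
-- φ(∅) = 0, and (iii) is φ(A ∪ A′) ≤ f(A ∪ A′) + 1 for A disjoint from A′.

open import Defs
open import Data.Nat using (ℕ; suc; _+_; _<_; _≤_)
open import Data.List using (List; length)
open import Data.Fin using (Fin)
open import Data.Fin.Subset using (Subset; _∈_; _⊆_; ∁; _∪_; Nonempty)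
open import Data.Product using (Σ; _×_)
open import Data.Sum using (_⊎_)
open import Relation.Nullary using (¬_)
open import Relation.Binary.PropositionalEquality using (_≡_)
open import Function.Bundles using (_⇔_)

open import Algebra.Properties.CommutativeSemigroup using (interchange)
open import Data.Bool using (Bool; true; false; _∧_; _∨_; if_then_else_)
open import Data.Bool.Properties using (∧-assoc; ∨-assoc; ∧-identityʳ; ∧-zeroʳ)
open import Data.Empty using (⊥-elim)
open import Data.Fin using (zero; suc; toℕ; fromℕ<)
open import Data.Fin.Properties using (toℕ-fromℕ<)
open import Data.Fin.Subset using (_∩_; _∉_; ⊥; Empty)
open import Data.Fin.Subset.Properties
  using (x∈∁p⇒x∉p; x∉p⇒x∈∁p; x∈p∪q⁻; x∈p∪q⁺; x∈p∩q⁻; p∩q⊆p; ⊆-trans; Empty-unique;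
         _∈?_; _⊆?_; nonempty?; anySubset?)
open import Data.List using (_∷_; []; _++_; [_]; _∷ʳ_; map; allFin; tabulate; take; lookup)
open import Data.List.Membership.Propositional using () renaming (_∈_ to _∈ᴸ_)
open import Data.List.Membership.Propositional.Properties using (∈-allFin)
open import Data.List.Properties using (map-tabulate; take-suc)
open import Data.List.Relation.Unary.Any using (here; there)
open import Data.Nat using (zero; z≤n; s≤s; _<ᵇ_; _<?_)
open import Data.Nat.ListAction using (sum)
open import Data.Nat.Properties
open import Data.Product using (_,_; ∃; ∃₂; proj₁; proj₂; curry)
open import Data.Sum using ([_,_]′; inj₁; inj₂)
open import Data.Vec.Properties using (lookup-zipWith; lookup⇒[]=; lookup-replicate)
open import Function using (_∘_; id; case_of_)
open import Function.Bundles using (mk⇔)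
open import Level using (0ℓ)
open import Relation.Binary.PropositionalEquality
  using (refl; sym; trans; cong; cong₂; subst; module ≡-Reasoning)
open import Relation.Nullary using (Dec; yes; no; ¬?)
open import Relation.Nullary.Decidable using (_×-dec_)
open import Relation.Unary using (Pred; Decidable)

open import Algebra.Properties.CommutativeMonoid.Sum +-0-commutativeMonoid
  using (∑-distrib-+; sum-cong-≗; sum-replicate-zero) renaming (sum to ∑)

-- Sums over Fin n

sum-tabulate : ∀ {n} (g : Fin n → ℕ) → sum (tabulate g) ≡ ∑ g
sum-tabulate {zero}  g = refl
sum-tabulate {suc n} g = cong (g zero +_) (sum-tabulate (g ∘ suc))

sum-map-allFin : ∀ {n} (g : Fin n → ℕ) → sum (map g (allFin n)) ≡ ∑ g
sum-map-allFin g = trans (cong sum (map-tabulate id g)) (sum-tabulate g)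

∑-mono-≤ : ∀ {n} {g h : Fin n → ℕ} → (∀ i → g i ≤ h i) → ∑ g ≤ ∑ h
∑-mono-≤ {zero}  _   = z≤n
∑-mono-≤ {suc n} g≤h = +-mono-≤ (g≤h zero) (∑-mono-≤ (g≤h ∘ suc))

∑-if : ∀ {n} (c : Bool) (g : Fin n → ℕ) →
  ∑ (λ i → if c then g i else 0) ≡ (if c then ∑ g else 0)
∑-if     true  g = refl
∑-if {n} false g = sum-replicate-zero n

∑-indicator : ∀ {n} (a : Fin n) (g : Fin n → ℕ) → ∑ (λ i → if a =ᵇ i then g i else 0) ≡ g a
∑-indicator {suc n} zero    g =
  trans (cong (g zero +_) (sum-replicate-zero n)) (+-identityʳ (g zero))
∑-indicator {suc n} (suc a) g = ∑-indicator a (g ∘ suc)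

∑₂ : ∀ {n} → (Fin n → Fin n → ℕ) → ℕ
∑₂ w = ∑ λ u → ∑ (w u)

sum₂-map-allFin : ∀ {n} (w : Fin n → Fin n → ℕ) →
  sum (map (λ u → sum (map (w u) (allFin n))) (allFin n)) ≡ ∑₂ w
sum₂-map-allFin w = trans (sum-map-allFin (λ u → sum (map (w u) (allFin _))))
                          (sum-cong-≗ λ u → sum-map-allFin (w u))

∑₂-cong : ∀ {n} {w w′ : Fin n → Fin n → ℕ} → (∀ u v → w u v ≡ w′ u v) → ∑₂ w ≡ ∑₂ w′
∑₂-cong w≡w′ = sum-cong-≗ λ u → sum-cong-≗ (w≡w′ u)

∑₂-mono-≤ : ∀ {n} {w w′ : Fin n → Fin n → ℕ} → (∀ u v → w u v ≤ w′ u v) → ∑₂ w ≤ ∑₂ w′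
∑₂-mono-≤ w≤w′ = ∑-mono-≤ λ u → ∑-mono-≤ (w≤w′ u)

∑₂-distrib-+ : ∀ {n} (w w′ : Fin n → Fin n → ℕ) →
  ∑₂ (λ u v → w u v + w′ u v) ≡ ∑₂ w + ∑₂ w′
∑₂-distrib-+ w w′ =
  trans (sum-cong-≗ λ u → ∑-distrib-+ (w u) (w′ u)) (∑-distrib-+ (∑ ∘ w) (∑ ∘ w′))

∑₂-+-mono-≤ : ∀ {n} {w₁ w₂ w₃ w₄ : Fin n → Fin n → ℕ} →
  (∀ u v → w₁ u v + w₂ u v ≤ w₃ u v + w₄ u v) → ∑₂ w₁ + ∑₂ w₂ ≤ ∑₂ w₃ + ∑₂ w₄
∑₂-+-mono-≤ {w₁ = w₁} {w₂} {w₃} {w₄} le = begin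
  ∑₂ w₁ + ∑₂ w₂                  ≡⟨ ∑₂-distrib-+ w₁ w₂ ⟨
  ∑₂ (λ u v → w₁ u v + w₂ u v)   ≤⟨ ∑₂-mono-≤ le ⟩
  ∑₂ (λ u v → w₃ u v + w₄ u v)   ≡⟨ ∑₂-distrib-+ w₃ w₄ ⟩
  ∑₂ w₃ + ∑₂ w₄                  ∎
  where open ≤-Reasoning

∑₂-zero : ∀ {n} {w : Fin n → Fin n → ℕ} → (∀ u v → w u v ≡ 0) → ∑₂ w ≡ 0
∑₂-zero {n} w≡0 =
  trans (∑₂-cong w≡0) (trans (sum-cong-≗ {n} λ _ → sum-replicate-zero n) (sum-replicate-zero n))

∑₂-indicator : ∀ {n} (a b : Fin n) (w : Fin n → Fin n → ℕ) →
  ∑₂ (λ u v → if a =ᵇ u then (if b =ᵇ v then w u v else 0) else 0) ≡ w a b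
∑₂-indicator a b w = begin
  ∑ (λ u → ∑ (λ v → if a =ᵇ u then (if b =ᵇ v then w u v else 0) else 0))
    ≡⟨ sum-cong-≗ (λ u → ∑-if (a =ᵇ u) (λ v → if b =ᵇ v then w u v else 0)) ⟩
  ∑ (λ u → if a =ᵇ u then ∑ (λ v → if b =ᵇ v then w u v else 0) else 0)
    ≡⟨ ∑-indicator a _ ⟩
  ∑ (λ v → if b =ᵇ v then w a v else 0)
    ≡⟨ ∑-indicator b (w a) ⟩
  w a b ∎
  where open ≡-Reasoning

mem-∪ : ∀ {n} (X Y : Subset n) u → mem (X ∪ Y) u ≡ mem X u ∨ mem Y u
mem-∪ X Y u = lookup-zipWith _∨_ u X Y

mem-∩ : ∀ {n} (X Y : Subset n) u → mem (X ∩ Y) u ≡ mem X u ∧ mem Y u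
mem-∩ X Y u = lookup-zipWith _∧_ u X Y

⊆∁⇒mem-disjoint : ∀ {n} {A B : Subset n} → A ⊆ ∁ B → ∀ x → mem A x ∧ mem B x ≡ false
⊆∁⇒mem-disjoint {A = A} {B} A⊆∁B x with mem A x in x∈A | mem B x in x∈B
... | false | _     = refl
... | true  | false = refl
... | true  | true  = ⊥-elim (x∈∁p⇒x∉p (A⊆∁B (lookup⇒[]= x A x∈A)) (lookup⇒[]= x B x∈B))

∪-⊆ : ∀ {n} {X Y D : Subset n} → X ⊆ D → Y ⊆ D → X ∪ Y ⊆ D
∪-⊆ {X = X} {Y} X⊆D Y⊆D = [ X⊆D , Y⊆D ]′ ∘ x∈p∪q⁻ X Y

-- Sums over the edges of a graph

onEdges : ∀ {n} → List (Edge n) → (Fin n → Fin n → ℕ) → Fin n → Fin n → ℕ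
onEdges es w u v = if adj es u v then w u v else 0

edgeSum : ∀ {n} → List (Edge n) → (Fin n → Fin n → ℕ) → ℕ
edgeSum es w = ∑₂ (onEdges es w)

adj-++ : ∀ {n} (es es′ : List (Edge n)) u v → adj (es ++ es′) u v ≡ adj es u v ∨ adj es′ u v
adj-++ []       es′ u v = refl
adj-++ (e ∷ es) es′ u v =
  trans (cong (_ ∨_) (adj-++ es es′ u v)) (sym (∨-assoc _ (adj es u v) (adj es′ u v)))

if-∨-≤ : ∀ (s s′ : Bool) (m : ℕ) →
  (if s ∨ s′ then m else 0) ≤ (if s then m else 0) + (if s′ then m else 0)
if-∨-≤ true  s′ m = m≤m+n m _
if-∨-≤ false s′ m = ≤-refl

edgeSum-++-≤ : ∀ {n} (es es′ : List (Edge n)) w →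
  edgeSum (es ++ es′) w ≤ edgeSum es w + edgeSum es′ w
edgeSum-++-≤ es es′ w =
  ≤-trans (∑₂-mono-≤ split) (≤-reflexive (∑₂-distrib-+ (onEdges es w) (onEdges es′ w)))
  where
  split : ∀ u v → onEdges (es ++ es′) w u v ≤ onEdges es w u v + onEdges es′ w u v
  split u v rewrite adj-++ es es′ u v = if-∨-≤ (adj es u v) (adj es′ u v) (w u v)

edgeSum-single-≤ : ∀ {n} (a b : Fin n) w → edgeSum [ (a , b) ] w ≤ w a b + w b a
edgeSum-single-≤ a b w = begin
  edgeSum [ (a , b) ] w
    ≤⟨ ∑₂-mono-≤ (λ u v → either-orientation (a =ᵇ u) (b =ᵇ v) (a =ᵇ v) (b =ᵇ u) (w u v)) ⟩
  ∑₂ (λ u v → indicator a b u v + indicator b a u v)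
    ≡⟨ ∑₂-distrib-+ (indicator a b) (indicator b a) ⟩
  ∑₂ (indicator a b) + ∑₂ (indicator b a)
    ≡⟨ cong₂ _+_ (∑₂-indicator a b w) (∑₂-indicator b a w) ⟩
  w a b + w b a ∎
  where
  open ≤-Reasoning
  indicator : _ → _ → _ → _ → ℕ
  indicator a b u v = if a =ᵇ u then (if b =ᵇ v then w u v else 0) else 0
  second-orientation : ∀ (x′ y′ : Bool) (m : ℕ) →
    (if (x′ ∧ y′) ∨ false then m else 0) ≤ 0 + (if y′ then (if x′ then m else 0) else 0)
  second-orientation true  true  m = ≤-refl
  second-orientation true  false m = z≤n
  second-orientation false y′    m = z≤n
  either-orientation : ∀ (x y x′ y′ : Bool) (m : ℕ) →
    (if ((x ∧ y) ∨ (x′ ∧ y′)) ∨ false then m else 0)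
      ≤ (if x then (if y then m else 0) else 0) + (if y′ then (if x′ then m else 0) else 0)
  either-orientation true  true  x′ y′ m = m≤m+n m _
  either-orientation true  false x′ y′ m = second-orientation x′ y′ m
  either-orientation false y     x′ y′ m = second-orientation x′ y′ m

G-suc : ∀ {n} (ms : List (Edge n)) t → t < length ms → ∃ λ e → G ms (suc t) ≡ G ms t ++ [ e ]
G-suc ms t t<len = lookup ms i ,
  subst (λ s → take (suc s) ms ≡ take s ms ∷ʳ lookup ms i) (toℕ-fromℕ< t<len) (take-suc ms i)
  where i = fromℕ< t<len

edgeSum-G-suc : ∀ {n} (ms : List (Edge n)) t → t < length ms →
  ∃₂ λ a b → ∀ w → edgeSum (G ms (suc t)) w ≤ edgeSum (G ms t) w + (w a b + w b a)
edgeSum-G-suc ms t t<len with G-suc ms t t<len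
... | (a , b) , G-suc≡ = a , b , λ w → begin
  edgeSum (G ms (suc t)) w                    ≡⟨ cong (λ es → edgeSum es w) G-suc≡ ⟩
  edgeSum (G ms t ++ [ (a , b) ]) w           ≤⟨ edgeSum-++-≤ (G ms t) [ (a , b) ] w ⟩
  edgeSum (G ms t) w + edgeSum [ (a , b) ] w  ≤⟨ +-monoʳ-≤ _ (edgeSum-single-≤ a b w) ⟩
  edgeSum (G ms t) w + (w a b + w b a)        ∎
  where open ≤-Reasoning

edgeSum-+-mono-≤ : ∀ {n} (es : List (Edge n)) {w₁ w₂ w₃ w₄ : Fin n → Fin n → ℕ} →
  (∀ u v → w₁ u v + w₂ u v ≤ w₃ u v + w₄ u v) →
  edgeSum es w₁ + edgeSum es w₂ ≤ edgeSum es w₃ + edgeSum es w₄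
edgeSum-+-mono-≤ es le = ∑₂-+-mono-≤ λ u v → gated (adj es u v) (le u v)
  where
  gated : ∀ {a b c d} (s : Bool) → a + b ≤ c + d →
    (if s then a else 0) + (if s then b else 0) ≤ (if s then c else 0) + (if s then d else 0)
  gated true  le = le
  gated false _  = z≤n

-- φ as an edge sum, and the effect of one move

pairWeight : ∀ {n} → Subset n → Subset n → Fin n → Fin n → ℕ
pairWeight A B u v = bool→ℕ (mem A u ∧ mem A v ∧ (toℕ u <ᵇ toℕ v)) + bool→ℕ (mem A u ∧ mem B v)

bool→ℕ-∧-+ : ∀ p q s →
  bool→ℕ (p ∧ s) + bool→ℕ (q ∧ s) ≡ (if s then bool→ℕ p + bool→ℕ q else 0)
bool→ℕ-∧-+ p q true  = cong₂ _+_ (cong bool→ℕ (∧-identityʳ p)) (cong bool→ℕ (∧-identityʳ q))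
bool→ℕ-∧-+ p q false = cong₂ _+_ (cong bool→ℕ (∧-zeroʳ p)) (cong bool→ℕ (∧-zeroʳ q))

∧-rotate : ∀ l x y s → l ∧ x ∧ y ∧ s ≡ (x ∧ y ∧ l) ∧ s
∧-rotate true  true  true  s = refl
∧-rotate true  true  false s = refl
∧-rotate true  false y     s = refl
∧-rotate false true  true  s = refl
∧-rotate false true  false s = refl
∧-rotate false false y     s = refl

φ≡edgeSum : ∀ {n} (ms : List (Edge n)) A B t → φ ms A B t ≡ edgeSum (G ms t) (pairWeight A B)
φ≡edgeSum ms A B t = begin
  φ ms A B t                           ≡⟨ cong₂ _+_ (sum₂-map-allFin inside) (sum₂-map-allFin across) ⟩
  ∑₂ inside + ∑₂ across                ≡⟨ ∑₂-distrib-+ inside across ⟨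
  ∑₂ (λ u v → inside u v + across u v) ≡⟨ ∑₂-cong pull-out-adj ⟩
  edgeSum es (pairWeight A B)          ∎
  where
  open ≡-Reasoning
  es = G ms t
  inside across : _ → _ → ℕ
  inside u v = bool→ℕ ((toℕ u <ᵇ toℕ v) ∧ mem A u ∧ mem A v ∧ adj es u v)
  across u v = bool→ℕ (mem A u ∧ mem B v ∧ adj es u v)
  pull-out-adj : ∀ u v → inside u v + across u v ≡ (if adj es u v then pairWeight A B u v else 0)
  pull-out-adj u v = begin
    inside u v + across u v
      ≡⟨ cong₂ (λ p q → bool→ℕ p + bool→ℕ q) (∧-rotate (toℕ u <ᵇ toℕ v) (mem A u) (mem A v) s)
                                              (sym (∧-assoc (mem A u) (mem B v) s)) ⟩
    bool→ℕ (both ∧ s) + bool→ℕ (one ∧ s)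
      ≡⟨ bool→ℕ-∧-+ both one s ⟩
    (if s then pairWeight A B u v else 0) ∎
    where
    s = adj es u v
    both = mem A u ∧ mem A v ∧ (toℕ u <ᵇ toℕ v)
    one = mem A u ∧ mem B v

φ-empty : ∀ {n} (ms : List (Edge n)) {A} B t → Empty A → φ ms A B t ≡ 0
φ-empty ms B t empty rewrite Empty-unique empty =
  trans (φ≡edgeSum ms ⊥ B t) (∑₂-zero no-weight)
  where
  no-weight : ∀ u v → (if adj (G ms t) u v then pairWeight ⊥ B u v else 0) ≡ 0
  no-weight u v rewrite lookup-replicate u false with adj (G ms t) u v
  ... | true  = refl
  ... | false = refl

<ᵇ-asym : ∀ m n → (m <ᵇ n) ∧ (n <ᵇ m) ≡ false
<ᵇ-asym zero    zero    = refl
<ᵇ-asym zero    (suc n) = refl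
<ᵇ-asym (suc m) zero    = refl
<ᵇ-asym (suc m) (suc n) = <ᵇ-asym m n

-- The pair {a,b} counts in at most one way: with both ends in A (and then in one orientation
-- only), or with one end in A and the other in the disjoint set B.
endpoints-≤1 : ∀ l l′ x y x′ y′ → l ∧ l′ ≡ false → x ∧ x′ ≡ false → y ∧ y′ ≡ false →
  (bool→ℕ (x ∧ y ∧ l) + bool→ℕ (x ∧ y′)) + (bool→ℕ (y ∧ x ∧ l′) + bool→ℕ (y ∧ x′)) ≤ 1
endpoints-≤1 true  false true  true  false false refl refl refl = ≤-refl
endpoints-≤1 false true  true  true  false false refl refl refl = ≤-refl
endpoints-≤1 false false true  true  false false refl refl refl = z≤n
endpoints-≤1 _     _     true  false false true  _    refl refl = ≤-refl
endpoints-≤1 _     _     true  false false false _    refl refl = z≤n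
endpoints-≤1 _     _     false true  true  false _    refl refl = ≤-refl
endpoints-≤1 _     _     false true  false false _    refl refl = z≤n
endpoints-≤1 _     _     false false _     _     _    _    _    = z≤n

pairWeight-sym-≤1 : ∀ {n} {A B : Subset n} → A ⊆ ∁ B → ∀ a b →
  pairWeight A B a b + pairWeight A B b a ≤ 1
pairWeight-sym-≤1 {A = A} {B} A⊆∁B a b = endpoints-≤1
  (toℕ a <ᵇ toℕ b) (toℕ b <ᵇ toℕ a) (mem A a) (mem A b) (mem B a) (mem B b)
  (<ᵇ-asym (toℕ a) (toℕ b)) (⊆∁⇒mem-disjoint A⊆∁B a) (⊆∁⇒mem-disjoint A⊆∁B b)

φ-suc-≤ : ∀ {n} (ms : List (Edge n)) t → t < length ms → ∀ {A B} → A ⊆ ∁ B →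
  φ ms A B (suc t) ≤ suc (φ ms A B t)
φ-suc-≤ ms t t<len {A} {B} A⊆∁B with edgeSum-G-suc ms t t<len
... | a , b , step = begin
  φ ms A B (suc t)                      ≡⟨ φ≡edgeSum ms A B (suc t) ⟩
  edgeSum (G ms (suc t)) w              ≤⟨ step w ⟩
  edgeSum (G ms t) w + (w a b + w b a)  ≤⟨ +-monoʳ-≤ _ (pairWeight-sym-≤1 A⊆∁B a b) ⟩
  edgeSum (G ms t) w + 1                ≡⟨ +-comm _ 1 ⟩
  suc (edgeSum (G ms t) w)              ≡⟨ cong suc (φ≡edgeSum ms A B t) ⟨
  suc (φ ms A B t)                      ∎
  where
  open ≤-Reasoning
  w = pairWeight A B

-- Supermodularity of φ and modularity of f

bool→ℕ-∧-supermodular : ∀ xu yu xv yv l → bool→ℕ (xu ∧ xv ∧ l) + bool→ℕ (yu ∧ yv ∧ l)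
  ≤ bool→ℕ ((xu ∨ yu) ∧ (xv ∨ yv) ∧ l) + bool→ℕ ((xu ∧ yu) ∧ (xv ∧ yv) ∧ l)
bool→ℕ-∧-supermodular true  true  true  true  l = ≤-refl
bool→ℕ-∧-supermodular true  true  true  false l = ≤-refl
bool→ℕ-∧-supermodular true  true  false true  l = ≤-reflexive (+-comm 0 (bool→ℕ l))
bool→ℕ-∧-supermodular true  true  false false l = z≤n
bool→ℕ-∧-supermodular true  false true  yv    l = ≤-refl
bool→ℕ-∧-supermodular true  false false yv    l = z≤n
bool→ℕ-∧-supermodular false true  true  true  l = ≤-reflexive (+-comm 0 (bool→ℕ l))
bool→ℕ-∧-supermodular false true  false true  l = ≤-reflexive (+-comm 0 (bool→ℕ l))
bool→ℕ-∧-supermodular false true  xv    false l = z≤n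
bool→ℕ-∧-supermodular false false xv    yv    l = z≤n

bool→ℕ-∧-modular : ∀ x y b →
  bool→ℕ (x ∧ b) + bool→ℕ (y ∧ b) ≡ bool→ℕ ((x ∨ y) ∧ b) + bool→ℕ ((x ∧ y) ∧ b)
bool→ℕ-∧-modular true  true  b = refl
bool→ℕ-∧-modular true  false b = refl
bool→ℕ-∧-modular false true  b = +-comm 0 (bool→ℕ b)
bool→ℕ-∧-modular false false b = refl

+-interchange : ∀ a b c d → (a + b) + (c + d) ≡ (a + c) + (b + d)
+-interchange = interchange +-commutativeSemigroup

-- pairWeight Z B u v, as a function of the memberships of u and v in Z.
pairWeight-supermodular′ : ∀ l b xu yu xv yv →
  let pw p q = bool→ℕ (p ∧ q ∧ l) + bool→ℕ (p ∧ b) in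
  pw xu xv + pw yu yv ≤ pw (xu ∨ yu) (xv ∨ yv) + pw (xu ∧ yu) (xv ∧ yv)
pairWeight-supermodular′ l b xu yu xv yv = begin
  (I xu xv + C xu) + (I yu yv + C yu)
    ≡⟨ +-interchange (I xu xv) (C xu) (I yu yv) (C yu) ⟩
  (I xu xv + I yu yv) + (C xu + C yu)
    ≤⟨ +-mono-≤ (bool→ℕ-∧-supermodular xu yu xv yv l)
                (≤-reflexive (bool→ℕ-∧-modular xu yu b)) ⟩
  (I (xu ∨ yu) (xv ∨ yv) + I (xu ∧ yu) (xv ∧ yv)) + (C (xu ∨ yu) + C (xu ∧ yu))
    ≡⟨ +-interchange (I (xu ∨ yu) (xv ∨ yv)) (I (xu ∧ yu) (xv ∧ yv))
                     (C (xu ∨ yu)) (C (xu ∧ yu)) ⟩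
  (I (xu ∨ yu) (xv ∨ yv) + C (xu ∨ yu)) + (I (xu ∧ yu) (xv ∧ yv) + C (xu ∧ yu)) ∎
  where
  open ≤-Reasoning
  I : Bool → Bool → ℕ
  I p q = bool→ℕ (p ∧ q ∧ l)
  C : Bool → ℕ
  C p = bool→ℕ (p ∧ b)

pairWeight-supermodular : ∀ {n} (X Y B : Subset n) u v →
  pairWeight X B u v + pairWeight Y B u v
    ≤ pairWeight (X ∪ Y) B u v + pairWeight (X ∩ Y) B u v
pairWeight-supermodular X Y B u v
  rewrite mem-∪ X Y u | mem-∪ X Y v | mem-∩ X Y u | mem-∩ X Y v =
  pairWeight-supermodular′ (toℕ u <ᵇ toℕ v) (mem B v) (mem X u) (mem Y u) (mem X v) (mem Y v)

φ-supermodular : ∀ {n} (ms : List (Edge n)) (X Y B : Subset n) t →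
  φ ms X B t + φ ms Y B t ≤ φ ms (X ∪ Y) B t + φ ms (X ∩ Y) B t
φ-supermodular ms X Y B t
  rewrite φ≡edgeSum ms X B t | φ≡edgeSum ms Y B t
        | φ≡edgeSum ms (X ∪ Y) B t | φ≡edgeSum ms (X ∩ Y) B t =
  edgeSum-+-mono-≤ (G ms t) (pairWeight-supermodular X Y B)

_⇂_ : ∀ {n} → (Fin n → ℕ) → Subset n → Fin n → ℕ
(f ⇂ A) v = if mem A v then f v else 0

fsum≡∑ : ∀ {n} (f : Fin n → ℕ) A → fsum f A ≡ ∑ (f ⇂ A)
fsum≡∑ f A = sum-map-allFin (f ⇂ A)

if-modular : ∀ x y (c : ℕ) →
  (if x ∨ y then c else 0) + (if x ∧ y then c else 0) ≡ (if x then c else 0) + (if y then c else 0)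
if-modular true  true  c = refl
if-modular true  false c = refl
if-modular false true  c = +-comm c 0
if-modular false false c = refl

fsum-modular : ∀ {n} (f : Fin n → ℕ) (X Y : Subset n) →
  fsum f (X ∪ Y) + fsum f (X ∩ Y) ≡ fsum f X + fsum f Y
fsum-modular f X Y = begin
  fsum f (X ∪ Y) + fsum f (X ∩ Y)                ≡⟨ cong₂ _+_ (fsum≡∑ f (X ∪ Y)) (fsum≡∑ f (X ∩ Y)) ⟩
  ∑ (f ⇂ (X ∪ Y)) + ∑ (f ⇂ (X ∩ Y))              ≡⟨ ∑-distrib-+ (f ⇂ (X ∪ Y)) (f ⇂ (X ∩ Y)) ⟨
  ∑ (λ v → (f ⇂ (X ∪ Y)) v + (f ⇂ (X ∩ Y)) v)    ≡⟨ sum-cong-≗ pointwise ⟩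
  ∑ (λ v → (f ⇂ X) v + (f ⇂ Y) v)                ≡⟨ ∑-distrib-+ (f ⇂ X) (f ⇂ Y) ⟩
  ∑ (f ⇂ X) + ∑ (f ⇂ Y)                          ≡⟨ cong₂ _+_ (fsum≡∑ f X) (fsum≡∑ f Y) ⟨
  fsum f X + fsum f Y                            ∎
  where
  open ≡-Reasoning
  pointwise : ∀ v → (f ⇂ (X ∪ Y)) v + (f ⇂ (X ∩ Y)) v ≡ (f ⇂ X) v + (f ⇂ Y) v
  pointwise v rewrite mem-∪ X Y v | mem-∩ X Y v = if-modular (mem X v) (mem Y v) (f v)

fsum-⊥ : ∀ {n} (f : Fin n → ℕ) → fsum f ⊥ ≡ 0
fsum-⊥ {n} f = begin
  fsum f ⊥        ≡⟨ fsum≡∑ f ⊥ ⟩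
  ∑ (f ⇂ ⊥)       ≡⟨ sum-cong-≗ (λ v → cong (λ b → if b then f v else 0) (lookup-replicate v false)) ⟩
  ∑ {n} (λ _ → 0) ≡⟨ sum-replicate-zero n ⟩
  0               ∎
  where open ≡-Reasoning

fsum-disjoint-∪ : ∀ {n} (f : Fin n → ℕ) {X Y : Subset n} → Empty (X ∩ Y) →
  fsum f (X ∪ Y) ≡ fsum f X + fsum f Y
fsum-disjoint-∪ f {X} {Y} X∩Y-empty = begin
  fsum f (X ∪ Y)                   ≡⟨ +-identityʳ _ ⟨
  fsum f (X ∪ Y) + 0               ≡⟨ cong (fsum f (X ∪ Y) +_) fsum-X∩Y≡0 ⟨
  fsum f (X ∪ Y) + fsum f (X ∩ Y)  ≡⟨ fsum-modular f X Y ⟩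
  fsum f X + fsum f Y              ∎
  where
  open ≡-Reasoning
  fsum-X∩Y≡0 : fsum f (X ∩ Y) ≡ 0
  fsum-X∩Y≡0 = trans (cong (fsum f) (Empty-unique X∩Y-empty)) (fsum-⊥ f)

-- Intersection-closed families

excess-∩-closed : ∀ {n} (g h : Subset n → ℕ) {D : Subset n} →
  (∀ X Y → g (X ∪ Y) + g (X ∩ Y) ≡ g X + g Y) →
  (∀ X Y → h X + h Y ≤ h (X ∪ Y) + h (X ∩ Y)) →
  (∀ Z → Z ⊆ D → h Z ≤ suc (g Z)) →
  ∀ {X Y} → X ⊆ D → Y ⊆ D → g X < h X → g Y < h Y → g (X ∩ Y) < h (X ∩ Y)
excess-∩-closed g h modular supermodular h≤suc-g {X} {Y} X⊆D Y⊆D gX<hX gY<hY =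
  +-cancelˡ-≤ (suc (g (X ∪ Y))) (suc (g (X ∩ Y))) (h (X ∩ Y)) (begin
    suc (g (X ∪ Y)) + suc (g (X ∩ Y))  ≡⟨ cong suc (+-suc (g (X ∪ Y)) (g (X ∩ Y))) ⟩
    suc (suc (g (X ∪ Y) + g (X ∩ Y)))  ≡⟨ cong (λ m → suc (suc m)) (modular X Y) ⟩
    suc (suc (g X + g Y))              ≡⟨ cong suc (+-suc (g X) (g Y)) ⟨
    suc (g X) + suc (g Y)              ≤⟨ +-mono-≤ gX<hX gY<hY ⟩
    h X + h Y                          ≤⟨ supermodular X Y ⟩
    h (X ∪ Y) + h (X ∩ Y)              ≤⟨ +-monoˡ-≤ (h (X ∩ Y)) (h≤suc-g (X ∪ Y) (∪-⊆ X⊆D Y⊆D)) ⟩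
    suc (g (X ∪ Y)) + h (X ∩ Y)        ∎)
  where open ≤-Reasoning

module ∩-Closed {n} {P : Pred (Subset n) 0ℓ} (P? : Decidable P)
  (∩-closed : ∀ {X Y} → P X → P Y → P (X ∩ Y)) where

  Avoidable : Fin n → Set
  Avoidable v = ∃ λ X → P X × v ∉ X

  avoidable? : ∀ v → Dec (Avoidable v)
  avoidable? v = anySubset? λ X → P? X ×-dec ¬? (v ∈? X)

  exclude : ∀ {v} → Dec (Avoidable v) → Subset n → Subset n
  exclude (yes (X , _)) L = L ∩ X
  exclude (no _)        L = L

  exclude-P : ∀ {v} (d : Dec (Avoidable v)) {L} → P L → P (exclude d L)
  exclude-P (yes (X , PX , _)) PL = ∩-closed PL PX
  exclude-P (no _)             PL = PL

  exclude-⊆ : ∀ {v} (d : Dec (Avoidable v)) {L} → exclude d L ⊆ L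
  exclude-⊆ (yes (X , _)) = proj₁ ∘ x∈p∩q⁻ _ X
  exclude-⊆ (no _)        = id

  exclude-unavoidable : ∀ {v} (d : Dec (Avoidable v)) {L} → v ∈ exclude d L → ¬ Avoidable v
  exclude-unavoidable (yes (X , _ , v∉X)) v∈L∩X = ⊥-elim (v∉X (proj₂ (x∈p∩q⁻ _ X v∈L∩X)))
  exclude-unavoidable (no unavoidable)    _     = unavoidable

  shrink : List (Fin n) → Subset n → Subset n
  shrink []       L = L
  shrink (v ∷ vs) L = exclude (avoidable? v) (shrink vs L)

  shrink-P : ∀ vs {L} → P L → P (shrink vs L)
  shrink-P []       PL = PL
  shrink-P (v ∷ vs) PL = exclude-P (avoidable? v) (shrink-P vs PL)

  shrink-unavoidable : ∀ vs {L v} → v ∈ᴸ vs → v ∈ shrink vs L → ¬ Avoidable v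
  shrink-unavoidable (v ∷ vs) (here refl)  v∈ = exclude-unavoidable (avoidable? v) v∈
  shrink-unavoidable (w ∷ vs) (there v∈vs) v∈ =
    shrink-unavoidable vs v∈vs (exclude-⊆ (avoidable? w) v∈)

  least : ∀ {A} → P A → Σ (Subset n) λ L → P L × (∀ {X} → P X → L ⊆ X)
  least {A} PA = L , shrink-P (allFin n) PA , L⊆
    where
    L = shrink (allFin n) A
    L⊆ : ∀ {X} → P X → L ⊆ X
    L⊆ {X} PX {v} v∈L with v ∈? X
    ... | yes v∈X = v∈X
    ... | no  v∉X = ⊥-elim (shrink-unavoidable (allFin n) (∈-allFin v) v∈L (X , PX , v∉X))

-- The family 𝒞

module Violation {n} (moves : List (Edge n)) (f : Fin n → ℕ) (B : Subset n) (t₀ : ℕ)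
  (t₀<len : t₀ < length moves) (φ≤f : ∀ A → A ⊆ ∁ B → φ moves A B t₀ ≤ fsum f A) where

  φ′ : Subset n → ℕ
  φ′ A = φ moves A B (suc t₀)

  Violated : Pred (Subset n) 0ℓ
  Violated A = A ⊆ ∁ B × fsum f A < φ′ A

  violated? : Decidable Violated
  violated? A = (A ⊆? ∁ B) ×-dec (fsum f A <? φ′ A)

  φ′≤suc-fsum : ∀ A → A ⊆ ∁ B → φ′ A ≤ suc (fsum f A)
  φ′≤suc-fsum A A⊆∁B = ≤-trans (φ-suc-≤ moves t₀ t₀<len A⊆∁B) (s≤s (φ≤f A A⊆∁B))

  violated⇒φ′≡suc-fsum : ∀ {A} → Violated A → φ′ A ≡ suc (fsum f A)
  violated⇒φ′≡suc-fsum {A} (A⊆∁B , f<φ′) = ≤-antisym (φ′≤suc-fsum A A⊆∁B) f<φ′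

  violated-∩ : ∀ {X Y} → Violated X → Violated Y → Violated (X ∩ Y)
  violated-∩ {X} {Y} (X⊆∁B , fX<φ′X) (Y⊆∁B , fY<φ′Y) =
    ⊆-trans (p∩q⊆p X Y) X⊆∁B ,
    excess-∩-closed (fsum f) φ′ (fsum-modular f) (λ X Y → φ-supermodular moves X Y B (suc t₀))
      φ′≤suc-fsum X⊆∁B Y⊆∁B fX<φ′X fY<φ′Y

  violated⇒nonempty : ∀ {A} → Violated A → Nonempty A
  violated⇒nonempty {A} (_ , f<φ′) with nonempty? A
  ... | yes nonempty = nonempty
  ... | no  empty    = ⊥-elim (n≮0 (subst (fsum f A <_) (φ-empty moves B (suc t₀) empty) f<φ′))

  violated-extension : ∀ {L A} → Violated L → A ⊆ ∁ (B ∪ L) → φ′ (A ∪ L) ≤ fsum f A + φ′ L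
  violated-extension {L} {A} vL@(L⊆∁B , _) A⊆∁B∪L = begin
    φ′ (A ∪ L)                ≤⟨ φ′≤suc-fsum (A ∪ L) (∪-⊆ A⊆∁B L⊆∁B) ⟩
    suc (fsum f (A ∪ L))      ≡⟨ cong suc (fsum-disjoint-∪ f A∩L-empty) ⟩
    suc (fsum f A + fsum f L) ≡⟨ +-suc (fsum f A) (fsum f L) ⟨
    fsum f A + suc (fsum f L) ≡⟨ cong (fsum f A +_) (violated⇒φ′≡suc-fsum vL) ⟨
    fsum f A + φ′ L           ∎
    where
    open ≤-Reasoning
    A⊆∁B : A ⊆ ∁ B
    A⊆∁B x∈A = x∉p⇒x∈∁p (x∈∁p⇒x∉p (A⊆∁B∪L x∈A) ∘ x∈p∪q⁺ ∘ inj₁)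
    A∩L-empty : Empty (A ∩ L)
    A∩L-empty (x , x∈A∩L) with x∈p∩q⁻ A L x∈A∩L
    ... | x∈A , x∈L = x∈∁p⇒x∉p (A⊆∁B∪L x∈A) (x∈p∪q⁺ (inj₂ x∈L))

  dichotomy : (∀ A → ¬ Violated A)
            ⊎ Σ (Subset n) λ L → Violated L × (∀ {X} → Violated X → L ⊆ X)
  dichotomy with anySubset? violated?
  ... | no  none     = inj₁ λ A vA → none (A , vA)
  ... | yes (_ , vA) = inj₂ (∩-Closed.least violated? violated-∩ vA)

lemma3p2 : (k n : ℕ) (moves : List (Edge n)) → LegalPlay k moves →
    (f : Fin n → ℕ) (B : Subset n) (t₀ : ℕ) →
    ¬ Saturated k (G moves t₀) → t₀ < length moves →
    (∀ (A : Subset n) → A ⊆ ∁ B → φ moves A B t₀ ≤ fsum f A) →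
    (∀ (A : Subset n) → A ⊆ ∁ B → ¬ (fsum f A < φ moves A B (suc t₀)))
    ⊎ Σ (Subset n) (λ A′ →
        (∀ (v : Fin n) → (v ∈ A′) ⇔ (∀ (A : Subset n) → A ⊆ ∁ B → fsum f A < φ moves A B (suc t₀) → v ∈ A))
        × Nonempty A′ × A′ ⊆ ∁ B × fsum f A′ < φ moves A′ B (suc t₀)
        × (∀ (A : Subset n) → A ⊆ ∁ B → fsum f A < φ moves A B (suc t₀) → φ moves A B (suc t₀) ≡ suc (fsum f A))
        × (∀ (A : Subset n) → A ⊆ ∁ (B ∪ A′) →
             φ moves (A ∪ A′) B (suc t₀) ≤ fsum f A + φ moves A′ B (suc t₀)))
lemma3p2 k n moves _ f B t₀ _ t₀<len φ≤f = case dichotomy of λ where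
    (inj₁ none) → inj₁ λ A → curry (none A)
    (inj₂ (A′ , vA′@(A′⊆∁B , f<φ′) , A′-least)) → inj₂
      ( A′
      , (λ v → mk⇔ (λ v∈A′ A → curry λ vA → A′-least {A} vA v∈A′)
                   (λ v∈all → v∈all A′ A′⊆∁B f<φ′))
      , violated⇒nonempty vA′ , (λ {x} → A′⊆∁B {x}) , f<φ′
      , (λ A → curry violated⇒φ′≡suc-fsum)
      , (λ A → violated-extension vA′))
  where open Violation moves f B t₀ t₀<len φ≤f
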